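{- Consider any instance of the Online Budgeted Repeated Matching (OBRM) problem (defined in the context) in which every edge weight satisfies $w(i,j)\le C_i$. Run the randomized algorithm RANDOMONLINEGREEDY (defined in the context). Then for every outcome of the coin flips and every server $i\in I$, the set $A_i(T)$ is feasible: the edges of $\bigcup_i A_i(T)$ selected at any single time step form a matching, and $W(A_i(T))\le C_i$.
   Context: OBRM problem: there is a set $I=\{1,\dots,n\}$ of servers, server $i$ having capacity $C_i>0$. At each time step $t\in\{1,\dots,T\}$ a set of jobs $J(t)$ and a set $E(t)$ of edges between servers $I$ and jobs $J(t)$ are revealed, forming the bipartite graph $G(t)=(I\cup J(t),E(t))$; each edge $e=(i,j)$ has a nonnegative weight $w(e)=w(i,j)$ (a job may have different weights on different servers). For a set of edges $F$, $W(F)=\sum_{e\in F}w(e)$. A set of edges $F$ is feasible if (i) for each $t$ the edges of $F$ in $E(t)$ form a matching, and (ii) for each server $i$ the total weight of edges of $F$ incident to $i$ is at most $C_i$. Choices must be made online and irrevocably. Subroutine GREEDY$(G,S)$: given a weighted bipartite graph $G$ and a set $S$ of servers, start with $M=\emptyset$, scan the edges of $G$ in non-increasing order of weight, and add edge $(i,j)$ to $M$ if $i\in S$ and $M\cup\{(i,j)\}$ is still a matching. Return $M$. RANDOMONLINEGREEDY: before the input, for each server $i$ flip an independent fair coin $v_i\in\{0,1\}$ ($\Pr[v_i=1]=\tfrac12$). Initially $S=I$ and $A_i(0)=B_i(0)=\emptyset$ for all $i$. For $t=1,\dots,T$: set $M(t)=$GREEDY$(G(t),S)$; for each $e=(i,j)\in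 M(t)$: set $B_i(t)=B_i(t-1)\cup\{e\}$; if $W(B_i(t))>\tfrac12 C_i$ remove $i$ from $S$; if ($v_i=1$ and $w(i,j)>\tfrac12C_i$) or ($v_i=0$ and $w(i,j)\le \tfrac12 C_i$) then set $A_i(t)=A_i(t-1)\cup\{e\}$. (Sets not updated at step $t$ are carried over unchanged.) The output is $A(T)=\bigcup_i A_i(T)$; also $B(T)=\bigcup_i B_i(T)$.
   Formalization: The edge weights $w(i,j)$ and the server capacities $C_i$ take values in the rationals. -}

module Defs where

open import Data.Bool using (Bool; true; false; _∧_; _∨_; not; if_then_else_)
open import Data.Nat as ℕ using (ℕ; zero; suc)
open import Data.Fin using (Fin)
import Data.Fin.Properties as FinP
import Data.Nat.Properties as ℕP
open import Data.List using (List; []; _∷_; _++_; map; filter; foldr; length; allFin; concatMap)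
open import Data.Bool.ListAction using (any)
open import Data.Product using (_×_; _,_; proj₁; proj₂)
open import Data.Rational using (ℚ; 0ℚ; ½; _+_; _*_; _≤_; _<_; _≥_)
import Data.Rational.Properties as ℚP
open import Data.List.Relation.Unary.All using (All)
open import Data.List.Relation.Unary.AllPairs using (AllPairs)
open import Data.List.Relation.Unary.Linked using (Linked)
open import Relation.Nullary using (does; ¬_)
open import Relation.Binary.PropositionalEquality using (_≡_; _≢_)

-- OBRM instances with n servers (servers are Fin n).
-- Jobs are identified by natural numbers (job ids of the step t).

record Edge (n : ℕ) : Set where
  constructor edge
  field
    server : Fin n
    job    : ℕ
    weight : ℚ
open Edge public

W : ∀ {n} → List (Edge n) → ℚ
W = foldr (λ e acc → weight e + acc) 0ℚ

IsMatching : ∀ {n} → List (Edge n) → Set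
IsMatching = AllPairs (λ e f → (server e ≢ server f) × (job e ≢ job f))

conflict : ∀ {n} → Edge n → Edge n → Bool
conflict e f = does (server e FinP.≟ server f) ∨ does (job e ℕP.≟ job f)

-- GREEDY(G, S): the edges of G(t) are given as a list already in
-- non-increasing order of weight (any tie-breaking); greedy scans this list
-- and keeps an edge if its server is in S and it conflicts with no kept edge.

greedyGo : ∀ {n} → (Fin n → Bool) → List (Edge n) → List (Edge n) → List (Edge n)
greedyGo S M [] = M
greedyGo S M (e ∷ es) =
  if S (server e) ∧ not (any (conflict e) M)
  then greedyGo S (M ++ (e ∷ [])) es
  else greedyGo S M es

GREEDY : ∀ {n} → List (Edge n) → (Fin n → Bool) → List (Edge n)
GREEDY G S = greedyGo S [] G

-- RANDOMONLINEGREEDY for a fixed outcome v : Fin n → Bool of the coins.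
-- Selected edges are tagged with their time step t (steps numbered 1..T).

TEdge : ℕ → Set
TEdge n = ℕ × Edge n

record State (n : ℕ) : Set where
  constructor state
  field
    S  : Fin n → Bool
    Bs : Fin n → List (TEdge n)
    As : Fin n → List (TEdge n)
open State public

_>ᵇ_ : ℚ → ℚ → Bool
x >ᵇ y = does (y ℚP.<? x)

upd : ∀ {n} {A : Set} → (Fin n → A) → Fin n → A → (Fin n → A)
upd f i a j = if does (j FinP.≟ i) then a else f j

processEdge : ∀ {n} → (C : Fin n → ℚ) → (v : Fin n → Bool) → ℕ →
              Edge n → State n → State n
processEdge C v t e (state S Bs As) =
  let i   = server e
      Bi  = Bs i ++ ((t , e) ∷ [])
      S'  = if W (map proj₂ Bi) >ᵇ (½ * C i) then upd S i false else S
      big = weight e >ᵇ (½ * C i)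
      take = (v i ∧ big) ∨ (not (v i) ∧ not big)
      As' = if take then upd As i (As i ++ ((t , e) ∷ [])) else As
  in state S' (upd Bs i Bi) As'

processAll : ∀ {n} → (C : Fin n → ℚ) → (v : Fin n → Bool) → ℕ →
             List (Edge n) → State n → State n
processAll C v t []       st = st
processAll C v t (e ∷ es) st = processAll C v t es (processEdge C v t e st)

step : ∀ {n} → (C : Fin n → ℚ) → (v : Fin n → Bool) → ℕ →
       List (Edge n) → State n → State n
step C v t G st = processAll C v t (GREEDY G (S st)) st

initState : ∀ {n} → State n
initState = state (λ _ → true) (λ _ → []) (λ _ → [])

runFrom : ∀ {n} → (C : Fin n → ℚ) → (v : Fin n → Bool) → ℕ →
          List (List (Edge n)) → State n → State n
runFrom C v t []       st = st
runFrom C v t (G ∷ Gs) st = runFrom C v (suc t) Gs (step C v t G st)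

randomOnlineGreedy : ∀ {n} → (C : Fin n → ℚ) → (v : Fin n → Bool) →
                     List (List (Edge n)) → State n
randomOnlineGreedy C v Gs = runFrom C v 1 Gs initState

unionA : ∀ {n} → State n → List (TEdge n)
unionA {n} st = concatMap (As st) (allFin n)

atTime : ∀ {n} → ℕ → List (TEdge n) → List (Edge n)
atTime t xs = map proj₂ (filter (λ x → proj₁ x ℕP.≟ t) xs)

-- Validity of an OBRM input step G(t) (given as list of edges):
-- nonnegative weights, w(i,j) ≤ C_i, at most one edge per (server, job)
-- pair (E(t) is a set of edges), listed in non-increasing weight order.

ValidStep : ∀ {n} → (Fin n → ℚ) → List (Edge n) → Set
ValidStep C G =
  All (λ e → 0ℚ ≤ weight e) G ×
  All (λ e → weight e ≤ C (server e)) G ×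
  AllPairs (λ e f → ¬ ((server e ≡ server f) × (job e ≡ job f))) G ×
  Linked (λ e f → weight f ≤ weight e) G

-- A server stays active while W(B_i) ≤ C_i/2, and every edge it receives goes into B_i,
-- so while it is active W(A_i) ≤ W(B_i) ≤ C_i/2; if its coin is 1, A_i is even empty,
-- since an edge heavier than C_i/2 would already push W(B_i) over C_i/2.  The edge that
-- retires a server is added to A_i only if it is heavy and the coin is 1, giving
-- W(A_i) ≤ 0 + w ≤ C_i, or light and the coin is 0, giving W(A_i) ≤ C_i/2 + C_i/2; after
-- that GREEDY never offers the server an edge again.  For the matching property, the edges
-- that enter A during step t all come from the matching M(t), and every edge of A from an
-- earlier step carries an earlier time tag.
module Submission where

open import Defs
open import Data.Bool using (Bool; true; false; _∧_; _∨_; not; if_then_else_)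
open import Data.Bool.ListAction using (any)
open import Data.Bool.Properties using (if-float; ∨-conicalˡ; ∨-conicalʳ)
open import Data.Empty using (⊥-elim)
open import Data.Fin using (Fin)
import Data.Fin.Properties as FinP
open import Data.List using (List; []; _∷_; _++_; map; allFin; concatMap)
open import Data.List.Relation.Unary.All as All using (All; []; _∷_)
import Data.List.Relation.Unary.All.Properties as AllP
open import Data.List.Relation.Unary.AllPairs using (AllPairs; []; _∷_)
import Data.List.Relation.Unary.AllPairs.Properties as AllPairsP
open import Data.Nat as ℕ using (ℕ; suc)
import Data.Nat.Properties as ℕP
open import Data.Product using (∃; _×_; _,_; proj₁; proj₂)
open import Data.Rational using (ℚ; 0ℚ; ½; _+_; _*_; _<_; _≤_)
import Data.Rational.Properties as ℚP
open import Function using (_on_)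
open import Relation.Binary.Definitions using (Symmetric)
open import Relation.Binary.PropositionalEquality
open import Relation.Nullary using (Dec; yes; no; ¬_)
open import Relation.Nullary.Reflects using (Reflects; ofʸ; ofⁿ)

p≤p+q : ∀ {p q} → 0ℚ ≤ q → p ≤ p + q
p≤p+q {p} {q} 0≤q = subst (_≤ p + q) (ℚP.+-identityʳ p) (ℚP.+-monoʳ-≤ p 0≤q)

p≤q+p : ∀ {p q} → 0ℚ ≤ q → p ≤ q + p
p≤q+p {p} {q} 0≤q = subst (p ≤_) (ℚP.+-comm p q) (p≤p+q 0≤q)

half+half : ∀ c → ½ * c + ½ * c ≡ c
half+half c = trans (sym (ℚP.*-distribʳ-+ c ½ ½)) (ℚP.*-identityˡ c)

half≤ : ∀ {c} → 0ℚ ≤ ½ * c → ½ * c ≤ c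
half≤ {c} 0≤h = subst (½ * c ≤_) (half+half c) (p≤p+q 0≤h)

half-nonNeg : ∀ {c} → 0ℚ < c → 0ℚ ≤ ½ * c
half-nonNeg 0<c = ℚP.*-monoˡ-≤-nonNeg ½ (ℚP.<⇒≤ 0<c)

-- A view of x >ᵇ y: rational comparison normalises under with, so one abstracts the
-- boolean x >ᵇ y together with above? x y instead of matching on y ℚP.<? x.
data Above (x y : ℚ) : Bool → Set where
  above : y < x → Above x y true
  below : x ≤ y → Above x y false

above? : ∀ x y → Above x y (x >ᵇ y)
above? x y = fromReflects (Dec.proof (y ℚP.<? x))
  where
  fromReflects : ∀ {b} → Reflects (y < x) b → Above x y b
  fromReflects (ofʸ y<x) = above y<x
  fromReflects (ofⁿ y≮x) = below (ℚP.≮⇒≥ y≮x)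

selects : Bool → Bool → Bool
selects coin heavy = (coin ∧ heavy) ∨ (not coin ∧ not heavy)

-- Budget c coin active β α relates W(B_i) = β and W(A_i) = α for a server of capacity c.
data Budget (c : ℚ) : Bool → Bool → ℚ → ℚ → Set where
  active₀ : ∀ {β α} → 0ℚ ≤ β → β ≤ ½ * c → α ≤ β → Budget c false true β α
  active₁ : ∀ {β α} → 0ℚ ≤ β → β ≤ ½ * c → α ≤ 0ℚ → Budget c true true β α
  retired : ∀ {coin β α} → α ≤ c → Budget c coin false β α

budget-init : ∀ {c} → 0ℚ < c → ∀ coin → Budget c coin true 0ℚ 0ℚ
budget-init 0<c false = active₀ ℚP.≤-refl (half-nonNeg 0<c) ℚP.≤-refl
budget-init 0<c true  = active₁ ℚP.≤-refl (half-nonNeg 0<c) ℚP.≤-refl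

budget-bound : ∀ {c coin active β α} → Budget c coin active β α → α ≤ c
budget-bound (active₀ 0≤β β≤h α≤β) = ℚP.≤-trans α≤β (ℚP.≤-trans β≤h (half≤ (ℚP.≤-trans 0≤β β≤h)))
budget-bound (active₁ 0≤β β≤h α≤0) =
  ℚP.≤-trans α≤0 (ℚP.≤-trans 0≤β (ℚP.≤-trans β≤h (half≤ (ℚP.≤-trans 0≤β β≤h))))
budget-bound (retired α≤c) = α≤c

budget-step : ∀ {c coin β α w} → 0ℚ ≤ w → w ≤ c → Budget c coin true β α →
  Budget c coin (if (β + w) >ᵇ (½ * c) then false else true) (β + w)
                (if selects coin (w >ᵇ (½ * c)) then α + w else α)
budget-step {c} {β = β} {α} {w} 0≤w w≤c budget
  with (β + w) >ᵇ (½ * c) | above? (β + w) (½ * c) | w >ᵇ (½ * c) | above? w (½ * c) | budget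
... | true | above _ | true | above _ | active₀ 0≤β β≤h α≤β =
  retired (budget-bound (active₀ 0≤β β≤h α≤β))
... | true | above _ | false | below w≤h | active₀ _ β≤h α≤β = retired (begin
  α + w         ≤⟨ ℚP.+-mono-≤ (ℚP.≤-trans α≤β β≤h) w≤h ⟩
  ½ * c + ½ * c ≡⟨ half+half c ⟩
  c             ∎)
  where open ℚP.≤-Reasoning
... | false | below β+w≤h | true | above _ | active₀ 0≤β _ α≤β =
  active₀ (ℚP.+-mono-≤ 0≤β 0≤w) β+w≤h (ℚP.≤-trans α≤β (p≤p+q 0≤w))
... | false | below β+w≤h | false | below _ | active₀ 0≤β _ α≤β =
  active₀ (ℚP.+-mono-≤ 0≤β 0≤w) β+w≤h (ℚP.+-monoˡ-≤ w α≤β)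
... | true | above _ | true | above _ | active₁ _ _ α≤0 =
  retired (ℚP.≤-trans (ℚP.+-monoˡ-≤ w α≤0) (subst (_≤ c) (sym (ℚP.+-identityˡ w)) w≤c))
... | true | above _ | false | below _ | active₁ _ _ α≤0 =
  retired (ℚP.≤-trans α≤0 (ℚP.≤-trans 0≤w w≤c))
... | false | below β+w≤h | true | above h<w | active₁ 0≤β _ _ =
  ⊥-elim (ℚP.<-irrefl refl (ℚP.<-≤-trans (ℚP.<-≤-trans h<w (p≤q+p 0≤β)) β+w≤h))
... | false | below β+w≤h | false | below _ | active₁ 0≤β _ α≤0 =
  active₁ (ℚP.+-mono-≤ 0≤β 0≤w) β+w≤h α≤0

AllPairs-snoc : ∀ {A : Set} {R : A → A → Set} {xs x} →
  AllPairs R xs → All (λ y → R y x) xs → AllPairs R (xs ++ x ∷ [])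
AllPairs-snoc Rxs Rx = AllPairsP.++⁺ Rxs ([] ∷ []) (All.map (_∷ []) Rx)

module _ {n : ℕ} {A : Set} where

  upd-elim : (P : Fin n → A → Set) {f : Fin n → A} {i : Fin n} {a : A} →
    (∀ j → j ≢ i → P j (f j)) → P i a → ∀ j → P j (upd f i a j)
  upd-elim P {i = i} other self j with j FinP.≟ i
  ... | yes refl = self
  ... | no j≢i = other j j≢i

  upd-≢ : (f : Fin n → A) {i j : Fin n} {a : A} → j ≢ i → upd f i a j ≡ f j
  upd-≢ f {i} {j} j≢i with j FinP.≟ i
  ... | yes j≡i = ⊥-elim (j≢i j≡i)
  ... | no _    = refl

module _ {n : ℕ} {A : Set} where

  record PairwiseFamily (R : A → A → Set) (F : Fin n → List A) : Set where
    field
      within : ∀ i → AllPairs R (F i)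
      across : ∀ {i j} → i ≢ j → All (λ x → All (R x) (F j)) (F i)

  open PairwiseFamily

  concat-pairwise : ∀ {R F} → PairwiseFamily R F → AllPairs R (concatMap F (allFin n))
  concat-pairwise RF = AllPairsP.concat⁺
    (AllP.map⁺ (AllP.tabulate⁺ (within RF)))
    (AllPairsP.map⁺ (AllPairsP.tabulate⁺ (across RF)))

  snoc-pairwise : ∀ {R F i x} → Symmetric R → PairwiseFamily R F → (∀ j → All (λ y → R y x) (F j)) →
    PairwiseFamily R (upd F i (F i ++ x ∷ []))
  snoc-pairwise {R} {F} {i} {x} sym RF Rx = record
    { within = upd-elim (λ _ → AllPairs R) (λ j _ → within RF j) (AllPairs-snoc (within RF i) (Rx i))
    ; across = λ {j} {k} → across′ j k
    }
    where
    F′ = upd F i (F i ++ x ∷ [])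
    Across : Fin n → List A → Set
    Across j ys = ∀ k → j ≢ k → All (λ y → All (R y) (F′ k)) ys

    across′ : ∀ j → Across j (F′ j)
    across′ = upd-elim Across
      (λ j j≢i → upd-elim (λ k zs → j ≢ k → All (λ y → All (R y) zs) (F j))
        (λ _ _ → across RF)
        (λ _ → All.zipWith (λ (Rys , Ryx) → AllP.++⁺ Rys (Ryx ∷ [])) (across RF j≢i , Rx j)))
      (upd-elim (λ k zs → i ≢ k → All (λ y → All (R y) zs) (F i ++ x ∷ []))
        (λ k _ i≢k → AllP.++⁺ (across RF i≢k) (All.map sym (Rx k) ∷ []))
        (λ i≢i → ⊥-elim (i≢i refl)))

module _ {n : ℕ} where

  Apart : Edge n → Edge n → Set
  Apart e f = (server e ≢ server f) × (job e ≢ job f)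

  Apart-sym : Symmetric Apart
  Apart-sym (s , j) = ≢-sym s , ≢-sym j

  Apartₜ : TEdge n → TEdge n → Set
  Apartₜ x y = proj₁ x ≡ proj₁ y → Apart (proj₂ x) (proj₂ y)

  Apartₜ-sym : Symmetric Apartₜ
  Apartₜ-sym {x} {y} Rxy y≡x = Apart-sym {x = proj₂ x} {y = proj₂ y} (Rxy (sym y≡x))

  atTime-matching : ∀ t {xs} → AllPairs Apartₜ xs → IsMatching (atTime t xs)
  atTime-matching t {xs} Rxs =
    AllPairsP.map⁺ (same-time (AllP.all-filter tag≟ xs) (AllPairsP.filter⁺ tag≟ Rxs))
    where
    tag≟ = λ (x : TEdge n) → proj₁ x ℕP.≟ t
    same-time : ∀ {ys} → All (λ y → proj₁ y ≡ t) ys → AllPairs Apartₜ ys → AllPairs (Apart on proj₂) ys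
    same-time [] [] = []
    same-time (x≡t ∷ ys≡t) (Rx ∷ Rys) =
      All.zipWith (λ (Rxy , y≡t) → Rxy (trans x≡t (sym y≡t))) (Rx , ys≡t) ∷ same-time ys≡t Rys

  Wₜ : List (TEdge n) → ℚ
  Wₜ xs = W (map proj₂ xs)

  Wₜ-snoc : ∀ xs t e → Wₜ (xs ++ (t , e) ∷ []) ≡ Wₜ xs + weight e
  Wₜ-snoc []            t e = trans (ℚP.+-identityʳ (weight e)) (sym (ℚP.+-identityˡ (weight e)))
  Wₜ-snoc ((_ , f) ∷ xs) t e =
    trans (cong (weight f +_) (Wₜ-snoc xs t e)) (sym (ℚP.+-assoc (weight f) (Wₜ xs) (weight e)))

does-∨-false : ∀ {P Q : Set} (P? : Dec P) (Q? : Dec Q) → Dec.does P? ∨ Dec.does Q? ≡ false → ¬ P × ¬ Q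
does-∨-false (no ¬p) (no ¬q) _ = ¬p , ¬q
does-∨-false (yes _) _       ()
does-∨-false (no _)  (yes _) ()

no-conflict⇒apart : ∀ {n} (e : Edge n) M → any (conflict e) M ≡ false → All (Apart e) M
no-conflict⇒apart e []      _  = []
no-conflict⇒apart e (f ∷ M) eq =
  does-∨-false (server e FinP.≟ server f) (job e ℕP.≟ job f) (∨-conicalˡ _ _ eq)
  ∷ no-conflict⇒apart e M (∨-conicalʳ _ _ eq)

module _ {n : ℕ} {P : Edge n → Set} (S : Fin n → Bool) where

  Selected : Edge n → Set
  Selected e = S (server e) ≡ true × P e

  greedyGo-sound : ∀ M G → IsMatching M → All Selected M → All P G →
    IsMatching (greedyGo S M G) × All Selected (greedyGo S M G)
  greedyGo-sound M []      Mm MS _ = Mm , MS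
  greedyGo-sound M (e ∷ G) Mm MS (Pe ∷ PG) with S (server e) in active | any (conflict e) M in free
  ... | true  | false = greedyGo-sound (M ++ e ∷ []) G
    (AllPairs-snoc Mm (All.map (λ {f} → Apart-sym {x = e} {y = f}) (no-conflict⇒apart e M free)))
    (AllP.++⁺ MS ((active , Pe) ∷ []))
    PG
  ... | true  | true  = greedyGo-sound M G Mm MS PG
  ... | false | _     = greedyGo-sound M G Mm MS PG

  GREEDY-sound : ∀ G → All P G → IsMatching (GREEDY G S) × All Selected (GREEDY G S)
  GREEDY-sound G = greedyGo-sound [] G [] []

Server : ℕ → Set
Server n = Bool × List (TEdge n) × List (TEdge n)

module _ {n : ℕ} where

  local : State n → Fin n → Server n
  local st i = S st i , Bs st i , As st i

  serve : ℚ → Bool → ℕ → Edge n → Server n → Server n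
  serve c coin t e (s , b , a) =
    (if Wₜ b′ >ᵇ (½ * c) then false else s) ,
    b′ ,
    (if selects coin (weight e >ᵇ (½ * c)) then a ++ (t , e) ∷ [] else a)
    where
    b′ = b ++ (t , e) ∷ []

  local-processEdge : ∀ C v t e st j →
    let i = server e in
    local (processEdge C v t e st) j ≡ upd (local st) i (serve (C i) (v i) t e (local st i)) j
  local-processEdge C v t e st j
    with Wₜ (Bs st (server e) ++ (t , e) ∷ []) >ᵇ (½ * C (server e))
       | selects (v (server e)) (weight e >ᵇ (½ * C (server e)))
  ... | true | true with j FinP.≟ server e
  ...   | yes refl = refl
  ...   | no _     = refl
  local-processEdge C v t e st j | true | false with j FinP.≟ server e
  ...   | yes refl = refl
  ...   | no _     = refl
  local-processEdge C v t e st j | false | true with j FinP.≟ server e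
  ...   | yes refl = refl
  ...   | no _     = refl
  local-processEdge C v t e st j | false | false with j FinP.≟ server e
  ...   | yes refl = refl
  ...   | no _     = refl

  Budgetₛ : ℚ → Bool → Server n → Set
  Budgetₛ c coin (s , b , a) = Budget c coin s (Wₜ b) (Wₜ a)

  serve-budget : ∀ {c coin} t e (x : Server n) → proj₁ x ≡ true → 0ℚ ≤ weight e → weight e ≤ c →
    Budgetₛ c coin x → Budgetₛ c coin (serve c coin t e x)
  serve-budget {c} {coin} t e (.true , b , a) refl 0≤w w≤c βα
    rewrite Wₜ-snoc b t e
          | if-float Wₜ (selects coin (weight e >ᵇ (½ * c))) {a ++ (t , e) ∷ []} {a}
          | Wₜ-snoc a t e
          = budget-step 0≤w w≤c βα

module Run {n : ℕ} (C : Fin n → ℚ) (v : Fin n → Bool) where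

  ValidEdge : Edge n → Set
  ValidEdge e = 0ℚ ≤ weight e × weight e ≤ C (server e)

  record Invariant (t : ℕ) (st : State n) : Set where
    field
      budget : ∀ i → Budgetₛ (C i) (v i) (local st i)
      past   : ∀ i → All (λ x → proj₁ x ℕ.< t) (As st i)
      apart  : PairwiseFamily Apartₜ (As st)

  -- es is the part of M(t) that is still to be processed in step t.
  record Pending (t : ℕ) (st : State n) (es : List (Edge n)) : Set where
    field
      matching : IsMatching es
      ready    : All (λ e → S st (server e) ≡ true × ValidEdge e) es
      fresh    : ∀ i → All (λ x → All (λ f → Apartₜ x (t , f)) es) (As st i)

  open Invariant
  open Pending

  S-processEdge-≢ : ∀ t e st {j} → j ≢ server e → S (processEdge C v t e st) j ≡ S st j
  S-processEdge-≢ t e st {j} j≢i =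
    cong proj₁ (trans (local-processEdge C v t e st j) (upd-≢ (local st) j≢i))

  As-processEdge : ∀ t e st (P : (Fin n → List (TEdge n)) → Set) →
    P (As st) → P (upd (As st) (server e) (As st (server e) ++ (t , e) ∷ [])) →
    P (As (processEdge C v t e st))
  As-processEdge t e st P keep add with selects (v (server e)) (weight e >ᵇ (½ * C (server e)))
  ... | true  = add
  ... | false = keep

  processEdge-invariant : ∀ {t e es st} → Invariant (suc t) st → Pending t st (e ∷ es) →
    Invariant (suc t) (processEdge C v t e st)
  processEdge-invariant {t} {e} {es} {st} inv pend = record
    { budget = budget′
    ; past   = As-processEdge t e st (λ F → ∀ i → All (λ x → proj₁ x ℕ.< suc t) (F i)) (past inv)
        (upd-elim (λ _ → All _) (λ j _ → past inv j)
          (AllP.++⁺ (past inv (server e)) (ℕP.n<1+n t ∷ [])))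
    ; apart  = As-processEdge t e st (PairwiseFamily Apartₜ) (apart inv)
        (snoc-pairwise (λ {x} {y} → Apartₜ-sym {x = x} {y = y}) (apart inv)
          (λ j → All.map All.head (fresh pend j)))
    }
    where
    budget′ : ∀ j → Budgetₛ (C j) (v j) (local (processEdge C v t e st) j)
    budget′ j with All.head (ready pend)
    ... | active , 0≤w , w≤c = subst (Budgetₛ (C j) (v j)) (sym (local-processEdge C v t e st j))
      (upd-elim (λ j → Budgetₛ (C j) (v j)) {f = local st} (λ j _ → budget inv j)
        (serve-budget t e (local st (server e)) active 0≤w w≤c (budget inv (server e))) j)

  processEdge-pending : ∀ {t e es st} → Pending t st (e ∷ es) → Pending t (processEdge C v t e st) es
  processEdge-pending {t} {e} {es} {st} pend with matching pend
  ... | e#es ∷ rest = record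
    { matching = rest
    ; ready    = All.zipWith (λ (e#f , active , valid) →
        trans (S-processEdge-≢ t e st (≢-sym (proj₁ e#f))) active , valid)
        (e#es , All.tail (ready pend))
    ; fresh    = As-processEdge t e st (λ F → ∀ i → All (λ x → All (λ f → Apartₜ x (t , f)) es) (F i))
        fresh′
        (upd-elim (λ _ → All _) (λ j _ → fresh′ j)
          (AllP.++⁺ (fresh′ (server e)) (All.map (λ e#f _ → e#f) e#es ∷ [])))
    }
    where
    fresh′ : ∀ i → All (λ x → All (λ f → Apartₜ x (t , f)) es) (As st i)
    fresh′ i = All.map All.tail (fresh pend i)

  processAll-invariant : ∀ {t st} es → Invariant (suc t) st → Pending t st es →
    Invariant (suc t) (processAll C v t es st)
  processAll-invariant []       inv _    = inv
  processAll-invariant (e ∷ es) inv pend =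
    processAll-invariant es (processEdge-invariant inv pend) (processEdge-pending pend)

  step-invariant : ∀ {t st} G → Invariant t st → ValidStep C G → Invariant (suc t) (step C v t G st)
  step-invariant {t} {st} G inv (nonNeg , bounded , _) =
    processAll-invariant (GREEDY G (S st)) inv′ pending
    where
    inv′ : Invariant (suc t) st
    inv′ = record
      { budget = budget inv ; past = λ i → All.map ℕP.m<n⇒m<1+n (past inv i) ; apart = apart inv }
    sound = GREEDY-sound {P = ValidEdge} (S st) G (All.zip (nonNeg , bounded))
    pending : Pending t st (GREEDY G (S st))
    pending = record { matching = proj₁ sound ; ready = proj₂ sound ; fresh = unseen }
      where
      unseen : ∀ i → All (λ x → All (λ f → Apartₜ x (t , f)) (GREEDY G (S st))) (As st i)
      unseen i =
        All.map (λ x<t → All.universal (λ _ x≡t → ⊥-elim (ℕP.<-irrefl x≡t x<t)) _) (past inv i)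

  runFrom-invariant : ∀ {t st} Gs → Invariant t st → All (ValidStep C) Gs →
    ∃ λ t′ → Invariant t′ (runFrom C v t Gs st)
  runFrom-invariant []       inv []          = _ , inv
  runFrom-invariant (G ∷ Gs) inv (valid ∷ vs) = runFrom-invariant Gs (step-invariant G inv valid) vs

  initial-invariant : (∀ i → 0ℚ < C i) → ∀ t → Invariant t initState
  initial-invariant 0<C t = record
    { budget = λ i → budget-init (0<C i) (v i)
    ; past   = λ _ → []
    ; apart  = record { within = λ _ → [] ; across = λ _ → [] }
    }

open Run using (Invariant; initial-invariant; runFrom-invariant)

lemma1 : (n : ℕ) (C : Fin n → ℚ) → (∀ i → 0ℚ < C i) →
    (Gs : List (List (Edge n))) → All (ValidStep C) Gs →
    (v : Fin n → Bool) →
    let final = randomOnlineGreedy C v Gs in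
    ((t : ℕ) → IsMatching (atTime t (unionA final))) ×
    ((i : Fin n) → W (map proj₂ (As final i)) ≤ C i)
lemma1 n C 0<C Gs valid v =
  (λ t → atTime-matching t (concat-pairwise (Invariant.apart inv))) ,
  (λ i → budget-bound (Invariant.budget inv i))
  where
  inv = proj₂ (runFrom-invariant C v Gs (initial-invariant C v 0<C 1) valid)
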